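{- Every expressivity situation $\mathcal{S}=(p,B,\Omega,\underline{\Omega},\Sigma,\Lambda,(f_\sigma)_{\sigma\in\Sigma},(\tau_\lambda)_{\lambda\in\Lambda})$ is adequate: for every $B$-coalgebra $x\colon X\to BX$, the codensity bisimilarity $\nu\bigl(x^*\circ\overline{B}^{\underline{\Omega},\tau}\bigr)$ satisfies $\nu\bigl(x^*\circ\overline{B}^{\underline{\Omega},\tau}\bigr)\sqsubseteq \bigwedge_{\varphi\in L_{\mathcal{S}}}[\![\varphi]\!]_x^{*}\underline{\Omega}$ in the fiber $\mathcal{E}_X$.
   Context: A $\mathbf{CLat}_\sqcap$-fibration is a fibration $p\colon\mathcal{E}\to\mathcal{C}$ whose fibers $\mathcal{E}_X$ are complete lattices (order $\sqsubseteq$, meets written $\bigwedge$) and whose reindexing functors $f^*$ preserve arbitrary meets. An expressivity situation $\mathcal{S}$ consists of: a $\mathbf{CLat}_\sqcap$-fibration $p\colon\mathcal{E}\to\mathcal{C}$; a functor $B\colon\mathcal{C}\to\mathcal{C}$; an object $\Omega\in\mathcal{C}$ with finite powers and an object $\underline{\Omega}\in\mathcal{E}$ above $\Omega$; a ranked alphabet $\Sigma$ with arrows $f_\sigma\colon\Omega^{\mathrm{rank}(\sigma)}\to\Omega$, each having a lifting $g_\sigma\colon\underline{\Omega}^{\mathrm{rank}(\sigma)}\to\underline{\Omega}$ in $\mathcal{E}$ with $pg_\sigma=f_\sigma$; a set $\Lambda$ and arrows $\tau_\lambda\colon B\Omega\to\Omega$. The logic $L_{\mathcal{S}}$ has formulas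 $\varphi::=\sigma(\varphi_1,\dots,\varphi_{\mathrm{rank}(\sigma)})\ (\sigma\in\Sigma)\mid\heartsuit_\lambda\varphi\ (\lambda\in\Lambda)$. For a $B$-coalgebra $x\colon X\to BX$, $[\![\sigma(\varphi_1,\dots,\varphi_n)]\!]_x=f_\sigma\circ\langle[\![\varphi_1]\!]_x,\dots,[\![\varphi_n]\!]_x\rangle$ and $[\![\heartsuit_\lambda\varphi]\!]_x=\tau_\lambda\circ B[\![\varphi]\!]_x\circ x$. The codensity lifting $\overline{B}^{\underline{\Omega},\tau}\colon\mathcal{E}\to\mathcal{E}$ is $\overline{B}^{\underline{\Omega},\tau}P=\bigwedge_{\lambda\in\Lambda,\,h\in\mathcal{E}(P,\underline{\Omega})}(\tau_\lambda\circ B(ph))^*\underline{\Omega}$, and the codensity bisimilarity of $x$ is the greatest fixed point of $x^*\circ\overline{B}^{\underline{\Omega},\tau}$ on $\mathcal{E}_X$. The logical equivalence of $x$ is $\bigwedge_{\varphi\in L_{\mathcal{S}}}[\![\varphi]\!]_x^*\underline{\Omega}$; adequacy means codensity bisimilarity $\sqsubseteq$ logical equivalence. -}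

module Defs where

open import Level using (Level; _⊔_; Lift; lift) renaming (suc to lsuc)
open import Data.Nat using (ℕ)
open import Data.Fin using (Fin)
open import Data.Product using (Σ; _×_; _,_)
open import Relation.Binary using (Rel; IsEquivalence; IsPartialOrder)

record Category (o ℓ : Level) : Set (lsuc (o ⊔ ℓ)) where
  infixr 9 _∘_
  infix 4 _≈_
  field
    Obj : Set o
    Hom : Obj → Obj → Set ℓ
    _≈_ : ∀ {A B} → Hom A B → Hom A B → Set ℓ
    ≈-equiv : ∀ {A B} → IsEquivalence (_≈_ {A} {B})
    id : ∀ {A} → Hom A A
    _∘_ : ∀ {A B C} → Hom B C → Hom A B → Hom A C
    assoc : ∀ {A B C D} {f : Hom A B} {g : Hom B C} {h : Hom C D} →
            (h ∘ g) ∘ f ≈ h ∘ (g ∘ f)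
    identityˡ : ∀ {A B} {f : Hom A B} → id ∘ f ≈ f
    identityʳ : ∀ {A B} {f : Hom A B} → f ∘ id ≈ f
    ∘-resp-≈ : ∀ {A B C} {f h : Hom B C} {g i : Hom A B} →
               f ≈ h → g ≈ i → f ∘ g ≈ h ∘ i

record Endofunctor {o ℓ : Level} (C : Category o ℓ) : Set (o ⊔ ℓ) where
  open Category C
  field
    F₀ : Obj → Obj
    F₁ : ∀ {A B} → Hom A B → Hom (F₀ A) (F₀ B)
    identity : ∀ {A} → F₁ (id {A}) ≈ id
    homomorphism : ∀ {A B C} {f : Hom A B} {g : Hom B C} →
                   F₁ (g ∘ f) ≈ F₁ g ∘ F₁ f
    F-resp-≈ : ∀ {A B} {f g : Hom A B} → f ≈ g → F₁ f ≈ F₁ g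

record CompleteLattice (c ι : Level) : Set (lsuc (c ⊔ ι)) where
  infix 4 _≈_ _⊑_
  field
    Carrier : Set c
    _≈_ : Rel Carrier ι
    _⊑_ : Rel Carrier ι
    isPartialOrder : IsPartialOrder _≈_ _⊑_
    ⋀ : {I : Set ι} → (I → Carrier) → Carrier
    ⋀-lower : ∀ {I : Set ι} (P : I → Carrier) (i : I) → ⋀ P ⊑ P i
    ⋀-greatest : ∀ {I : Set ι} (P : I → Carrier) (Q : Carrier) →
                 (∀ i → Q ⊑ P i) → Q ⊑ ⋀ P

record IsGreatestFixedPoint {c ι : Level} (L : CompleteLattice c ι)
         (F : CompleteLattice.Carrier L → CompleteLattice.Carrier L)
         (ν : CompleteLattice.Carrier L) : Set (c ⊔ ι) where
  open CompleteLattice L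
  field
    fixed : ν ≈ F ν
    greatest : ∀ P → P ≈ F P → P ⊑ ν

-- CLat_⊓-fibrations, presented (equivalently, since fibres are posets)
-- as their indexed form: a complete lattice E_X for each object X and
-- meet-preserving reindexing maps f^* : E_Y → E_X, functorial in f.

module _ {o ℓ : Level} (C : Category o ℓ) where
  open Category C

  record CLatFibration (c : Level) : Set (o ⊔ lsuc ℓ ⊔ lsuc c) where
    field
      Fib : Obj → CompleteLattice c ℓ
      reindex : ∀ {X Y} → Hom X Y →
                CompleteLattice.Carrier (Fib Y) → CompleteLattice.Carrier (Fib X)
      reindex-cong : ∀ {X Y} (f : Hom X Y) {P Q : CompleteLattice.Carrier (Fib Y)} →
                     CompleteLattice._≈_ (Fib Y) P Q →
                     CompleteLattice._≈_ (Fib X) (reindex f P) (reindex f Q)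
      reindex-resp-≈ : ∀ {X Y} {f g : Hom X Y} (P : CompleteLattice.Carrier (Fib Y)) →
                       f ≈ g → CompleteLattice._≈_ (Fib X) (reindex f P) (reindex g P)
      reindex-meet : ∀ {X Y} (f : Hom X Y) {I : Set ℓ}
                     (P : I → CompleteLattice.Carrier (Fib Y)) →
                     CompleteLattice._≈_ (Fib X)
                       (reindex f (CompleteLattice.⋀ (Fib Y) P))
                       (CompleteLattice.⋀ (Fib X) (λ i → reindex f (P i)))
      reindex-id : ∀ {X} (P : CompleteLattice.Carrier (Fib X)) →
                   CompleteLattice._≈_ (Fib X) (reindex id P) P
      reindex-∘ : ∀ {X Y Z} (g : Hom Y Z) (f : Hom X Y)
                  (P : CompleteLattice.Carrier (Fib Z)) →
                  CompleteLattice._≈_ (Fib X) (reindex (g ∘ f) P) (reindex f (reindex g P))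

  record FinitePowers (Ω : Obj) : Set (o ⊔ ℓ) where
    field
      pow : ℕ → Obj
      π : ∀ {n} → Fin n → Hom (pow n) Ω
      ⟨_⟩ : ∀ {n X} → (Fin n → Hom X Ω) → Hom X (pow n)
      π-⟨⟩ : ∀ {n X} (fs : Fin n → Hom X Ω) (i : Fin n) → π i ∘ ⟨ fs ⟩ ≈ fs i
      ⟨⟩-unique : ∀ {n X} (fs : Fin n → Hom X Ω) (h : Hom X (pow n)) →
                  (∀ i → π i ∘ h ≈ fs i) → h ≈ ⟨ fs ⟩

module _ {o ℓ c : Level} {C : Category o ℓ} (p : CLatFibration C c) where
  open Category C
  open CLatFibration p

  E : Obj → Set c
  E X = CompleteLattice.Carrier (Fib X)

  -- E-arrows P → Q above f : X → Y  (fibres are posets: P ⊑ f^* Q)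
  EHomAbove : ∀ {X Y} → E X → E Y → Hom X Y → Set ℓ
  EHomAbove {X} P Q f = CompleteLattice._⊑_ (Fib X) P (reindex f Q)

  EHom : ∀ {X Y} → E X → E Y → Set ℓ
  EHom {X} {Y} P Q = Σ (Hom X Y) (EHomAbove P Q)

  -- the power Ω̲^n in E, lying above Ω^n: the product ⋀_i π_i^* Ω̲
  powE : ∀ {Ω} (pw : FinitePowers C Ω) → E Ω → (n : ℕ) → E (FinitePowers.pow pw n)
  powE {Ω} pw Ω̲ n =
    CompleteLattice.⋀ (Fib (FinitePowers.pow pw n))
      {Lift ℓ (Fin n)} (λ { (lift i) → reindex (FinitePowers.π pw i) Ω̲ })

record ExpressivitySituation {o ℓ : Level} (C : Category o ℓ) (c : Level)
       : Set (o ⊔ lsuc ℓ ⊔ lsuc c) where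
  open Category C
  field
    p : CLatFibration C c
    B : Endofunctor C
    Ω : Obj
    powers : FinitePowers C Ω
    Ω̲ : E p Ω
    Sig : Set ℓ
    rank : Sig → ℕ
    f : (σ : Sig) → Hom (FinitePowers.pow powers (rank σ)) Ω
    g : (σ : Sig) → EHomAbove p (powE p powers Ω̲ (rank σ)) Ω̲ (f σ)
    Λ : Set ℓ
    τ : Λ → Hom (Endofunctor.F₀ B Ω) Ω

module _ {o ℓ c : Level} {C : Category o ℓ} (S : ExpressivitySituation C c) where
  open Category C
  open ExpressivitySituation S
  open CLatFibration p
  open FinitePowers powers
  open Endofunctor B

  data Formula : Set ℓ where
    op : (σ : Sig) → (Fin (rank σ) → Formula) → Formula
    ♡ : Λ → Formula → Formula

  ⟦_⟧ : Formula → ∀ {X} → Hom X (F₀ X) → Hom X Ω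
  ⟦ op σ φs ⟧ x = f σ ∘ ⟨ (λ i → ⟦ φs i ⟧ x) ⟩
  ⟦ ♡ λ' φ ⟧ x = τ λ' ∘ (F₁ (⟦ φ ⟧ x) ∘ x)

  codensityLifting : ∀ {X} → E p X → E p (F₀ X)
  codensityLifting {X} P =
    CompleteLattice.⋀ (Fib (F₀ X)) {Λ × EHom p P Ω̲}
      (λ { (λ' , (h , _)) → reindex (τ λ' ∘ F₁ h) Ω̲ })

  -- codensity bisimilarity is the greatest fixed point of this map on E_X
  bisimMap : ∀ {X} → Hom X (F₀ X) → E p X → E p X
  bisimMap x P = reindex x (codensityLifting P)

  logicalEquivalence : ∀ {X} → Hom X (F₀ X) → E p X
  logicalEquivalence {X} x =
    CompleteLattice.⋀ (Fib X) {Formula} (λ φ → reindex (⟦ φ ⟧ x) Ω̲)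

{-# OPTIONS --safe #-}
module Submission where

-- Every formula φ of L_S denotes a map ⟦φ⟧ : X → Ω that lifts to an E-arrow from any
-- post-fixed point P ⊑ x^*(B̄ P) into Ω̲, by induction on φ: a modality is lifted because
-- B̄ P is by definition below (τ_λ ∘ B h)^* Ω̲ for every lift h : P → Ω̲, and a connective
-- σ by tupling the lifts of its arguments into Ω̲^n and composing with g_σ. The greatest
-- fixed point is in particular post-fixed, hence below every ⟦φ⟧^* Ω̲.

open import Level using (Level; Lift; lift)
open import Data.Bool using (Bool; true; false)
open import Data.Fin using (Fin)
open import Data.Product using (_,_)
open import Relation.Binary using (IsEquivalence)
open import Relation.Binary.Bundles using (Poset)
import Relation.Binary.Reasoning.PartialOrder as PartialOrderReasoning
open import Defs

module _ {c ι : Level} (L : CompleteLattice c ι) where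
  open CompleteLattice L

  poset : Poset c ι ι
  poset = record { isPartialOrder = isPartialOrder }

  open Poset poset using (antisym; refl)

  pair : Carrier → Carrier → Lift ι Bool → Carrier
  pair P Q (lift true) = P
  pair P Q (lift false) = Q

  ⊑⇒≈⋀-pair : ∀ {P Q} → P ⊑ Q → P ≈ ⋀ (pair P Q)
  ⊑⇒≈⋀-pair P⊑Q = antisym
    (⋀-greatest _ _ (λ { (lift true) → refl ; (lift false) → P⊑Q }))
    (⋀-lower _ (lift true))

module _ {o ℓ c : Level} {C : Category o ℓ} (p : CLatFibration C c) where
  open Category C
  open CLatFibration p

  private
    module ⊑-Reasoning (X : Obj) = PartialOrderReasoning (poset (Fib X))
    module Fib (X : Obj) where
      open CompleteLattice (Fib X) public using (_⊑_; ⋀; ⋀-lower; ⋀-greatest)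
      open Poset (poset (Fib X)) public using (trans; reflexive; module Eq)

  -- Reindexing preserves the meet of {P, Q}, which is P exactly when P ⊑ Q.
  reindex-mono : ∀ {X Y} (f : Hom X Y) {P Q : E p Y} →
                 Fib._⊑_ Y P Q → Fib._⊑_ X (reindex f P) (reindex f Q)
  reindex-mono {X} {Y} f {P} {Q} P⊑Q = begin
    reindex f P                                    ≈⟨ reindex-cong f (⊑⇒≈⋀-pair (Fib Y) P⊑Q) ⟩
    reindex f (Fib.⋀ Y (pair (Fib Y) P Q))         ≈⟨ reindex-meet f (pair (Fib Y) P Q) ⟩
    Fib.⋀ X (λ b → reindex f (pair (Fib Y) P Q b)) ≤⟨ Fib.⋀-lower X _ (lift false) ⟩
    reindex f Q                                    ∎
    where open ⊑-Reasoning X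

  EHomAbove-∘ : ∀ {X Y Z} {P : E p X} {Q : E p Y} {R : E p Z} {f : Hom X Y} {g : Hom Y Z} →
                EHomAbove p P Q f → EHomAbove p Q R g → EHomAbove p P R (g ∘ f)
  EHomAbove-∘ {X} {P = P} {Q} {R} {f} {g} P→Q Q→R = begin
    P                          ≤⟨ P→Q ⟩
    reindex f Q                ≤⟨ reindex-mono f Q→R ⟩
    reindex f (reindex g R)    ≈⟨ reindex-∘ g f R ⟨
    reindex (g ∘ f) R          ∎
    where open ⊑-Reasoning X

  EHomAbove-resp-≈ : ∀ {X Y} {P : E p X} {Q : E p Y} {f g : Hom X Y} →
                     f ≈ g → EHomAbove p P Q f → EHomAbove p P Q g
  EHomAbove-resp-≈ {X} {P = P} {Q} {f} {g} f≈g P→Q = begin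
    P            ≤⟨ P→Q ⟩
    reindex f Q  ≈⟨ reindex-resp-≈ Q f≈g ⟩
    reindex g Q  ∎
    where open ⊑-Reasoning X

  module _ {Ω : Obj} (pw : FinitePowers C Ω) (Ω̲ : E p Ω) where
    open FinitePowers pw

    ⟨⟩-lift : ∀ {n X} {P : E p X} (hs : Fin n → Hom X Ω) →
              (∀ i → EHomAbove p P Ω̲ (hs i)) → EHomAbove p P (powE p pw Ω̲ n) ⟨ hs ⟩
    ⟨⟩-lift {n} {X} {P} hs lifts = Fib.trans X
      (Fib.⋀-greatest X _ P (λ { (lift i) → component i }))
      (Fib.reflexive X (Fib.Eq.sym X (reindex-meet ⟨ hs ⟩ _)))
      where
      open ⊑-Reasoning X
      component : ∀ i → Fib._⊑_ X P (reindex ⟨ hs ⟩ (reindex (π i) Ω̲))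
      component i = begin
        P                                ≤⟨ lifts i ⟩
        reindex (hs i) Ω̲                 ≈⟨ reindex-resp-≈ Ω̲ (IsEquivalence.sym ≈-equiv (π-⟨⟩ hs i)) ⟩
        reindex (π i ∘ ⟨ hs ⟩) Ω̲         ≈⟨ reindex-∘ (π i) ⟨ hs ⟩ Ω̲ ⟩
        reindex ⟨ hs ⟩ (reindex (π i) Ω̲) ∎

module _ {o ℓ c : Level} {C : Category o ℓ} (S : ExpressivitySituation C c) where
  open Category C
  open ExpressivitySituation S
  open Endofunctor B

  codensityLifting-lift : ∀ {X} {P : E p X} (λ' : Λ) {h : Hom X Ω} →
                          EHomAbove p P Ω̲ h →
                          EHomAbove p (codensityLifting S P) Ω̲ (τ λ' ∘ F₁ h)
  codensityLifting-lift {X} λ' {h} P→Ω̲ =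
    CompleteLattice.⋀-lower (CLatFibration.Fib p (F₀ X)) _ (λ' , (h , P→Ω̲))

  module _ {X : Obj} (x : Hom X (F₀ X)) {P : E p X}
           (postfixed : CompleteLattice._⊑_ (CLatFibration.Fib p X) P (bisimMap S x P)) where

    formula-lift : ∀ φ → EHomAbove p P Ω̲ (⟦_⟧ S φ x)
    formula-lift (op σ φs) =
      EHomAbove-∘ p (⟨⟩-lift p powers Ω̲ _ (λ i → formula-lift (φs i))) (g σ)
    formula-lift (♡ λ' φ) =
      EHomAbove-resp-≈ p assoc (EHomAbove-∘ p postfixed (codensityLifting-lift λ' (formula-lift φ)))

    postfixed⊑logicalEquivalence :
      CompleteLattice._⊑_ (CLatFibration.Fib p X) P (logicalEquivalence S x)
    postfixed⊑logicalEquivalence =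
      CompleteLattice.⋀-greatest (CLatFibration.Fib p X) _ P formula-lift

mainTheorem1 : ∀ {o ℓ c : Level} {C : Category o ℓ} (S : ExpressivitySituation C c)
    {X : Category.Obj C}
    (x : Category.Hom C X (Endofunctor.F₀ (ExpressivitySituation.B S) X))
    (ν : E (ExpressivitySituation.p S) X) →
    IsGreatestFixedPoint (CLatFibration.Fib (ExpressivitySituation.p S) X) (bisimMap S x) ν →
    CompleteLattice._⊑_ (CLatFibration.Fib (ExpressivitySituation.p S) X) ν (logicalEquivalence S x)
mainTheorem1 S {X} x ν gfp = postfixed⊑logicalEquivalence S x ν⊑bisimMap-ν
  where
  ν⊑bisimMap-ν : CompleteLattice._⊑_ (CLatFibration.Fib (ExpressivitySituation.p S) X)
                   ν (bisimMap S x ν)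
  ν⊑bisimMap-ν = Poset.reflexive (poset (CLatFibration.Fib (ExpressivitySituation.p S) X))
                                 (IsGreatestFixedPoint.fixed gfp)
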